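{- Let $n\geq 4$ and let $H_n$ be the graph with vertex set $\{v_{i,j} : i\in\{0,\dots,n-1\},\ j\in\mathbb Z_3\}$ in which $v_{i,j}v_{i,j'}$ is an edge for all $i$ and $j\neq j'$, $v_{i,j}v_{i+1,j}$ is an edge for $0\leq i\leq n-2$, and $v_{0,j}v_{n-1,-j}$ is an edge for all $j\in\mathbb Z_3$ (no other edges). For $i\in\{0,\dots,n-1\}$ let $C_i=\{v_{i,j}: j\in\mathbb Z_3\}$ and for $j\in\mathbb Z_3$ let $R_j=\{v_{i,j}: 0\leq i\leq n-1\}$. Let $W\subseteq V(H_n)$. In each of the following cases, the graph $H_n^{(W)}$ has chromatic number at least $5$ and is not $5$-critical: (a) there is some $i\in\{0,\dots,n-1\}$ such that $|W\cap C_i|\geq 2$; (b) $W$ contains at least $n-1$ vertices of $R_0$ and $n$ is odd; (c) the subgraph of $H_n$ induced on $W\setminus R_0$ contains a path with at least $n$ vertices and $n$ is even.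
   Context: Graphs are simple. Replicating a vertex $w$ means adding a new vertex $w'$ adjacent to $w$ and all neighbours of $w$; $H_n^{(W)}$ denotes the graph obtained by replicating every vertex of $W$ in sequence (result independent of the order). A graph is $5$-critical if it has chromatic number $5$ and deleting any vertex yields a $4$-colourable graph. -}

module Defs where

open import Data.Nat using (ℕ; zero; suc; _∸_; _≥_)
open import Data.Fin using (Fin; toℕ) renaming (zero to fz; suc to fs)
open import Data.Bool using (Bool; true; false; not)
open import Data.Maybe using (Maybe; just; nothing)
open import Data.Product using (Σ; ∃; _×_; _,_; proj₁)
open import Data.Sum using (_⊎_)
open import Data.Empty using (⊥)
open import Data.Unit using (⊤)
open import Data.List using (List; []; _∷_; map; filter; length; cartesianProduct; allFin)
open import Data.List.Relation.Unary.All using (All)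
open import Data.List.Relation.Unary.Unique.Propositional using (Unique)
open import Relation.Nullary using (¬_)
open import Relation.Binary.PropositionalEquality using (_≡_; _≢_)
open import Data.Bool.Properties using (T?)
open import Data.Bool using (T)

record Graph : Set₁ where
  field
    V : Set
    E : V → V → Set
open Graph public

Colourable : ℕ → Graph → Set
Colourable k G = Σ (V G → Fin k) λ c → ∀ x y → E G x y → c x ≢ c y

delete : (G : Graph) → V G → Graph
delete G v = record { V = Σ (V G) (λ u → u ≢ v)
                    ; E = λ { (x , _) (y , _) → E G x y } }

χ≥5 : Graph → Set
χ≥5 G = ¬ Colourable 4 G

Critical5 : Graph → Set
Critical5 G = (Colourable 5 G × ¬ Colourable 4 G)
            × (∀ v → Colourable 4 (delete G v))

-- Replication of a vertex w: new vertex w' (= nothing) adjacent to w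
-- and to all neighbours of w.

replicate : (G : Graph) → V G → Graph
replicate G w = record { V = Maybe (V G) ; E = E' }
  where
  E' : Maybe (V G) → Maybe (V G) → Set
  E' (just x) (just y) = E G x y
  E' nothing  (just y) = (y ≡ w) ⊎ E G w y
  E' (just x) nothing  = (x ≡ w) ⊎ E G x w
  E' nothing  nothing  = ⊥

-- replicate the vertices of a list in sequence (last element first;
-- the result does not depend on the order), together with the embedding
-- of the original vertices into the new graph
replicateAll : (G : Graph) → List (V G) → Σ Graph (λ G' → V G → V G')
replicateAll G []       = G , (λ v → v)
replicateAll G (w ∷ ws) with replicateAll G ws
... | G' , e = replicate G' (e w) , (λ v → just (e v))

-- The graph H_n : vertices v_{i,j} = (i , j), i ∈ Fin n, j ∈ ℤ₃ = Fin 3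

neg3 : Fin 3 → Fin 3
neg3 fz           = fz
neg3 (fs fz)      = fs (fs fz)
neg3 (fs (fs _))  = fs fz

HV : ℕ → Set
HV n = Fin n × Fin 3

HE : (n : ℕ) → HV n → HV n → Set
HE n (i , j) (i' , j') =
    (i ≡ i' × j ≢ j')
  ⊎ (j ≡ j' × toℕ i' ≡ suc (toℕ i))
  ⊎ (j ≡ j' × toℕ i ≡ suc (toℕ i'))
  ⊎ (toℕ i ≡ 0 × toℕ i' ≡ n ∸ 1 × j' ≡ neg3 j)
  ⊎ (toℕ i' ≡ 0 × toℕ i ≡ n ∸ 1 × j ≡ neg3 j')

H : ℕ → Graph
H n = record { V = HV n ; E = HE n }

Subset : ℕ → Set
Subset n = HV n → Bool

elems : (n : ℕ) → Subset n → List (HV n)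
elems n W = filter (λ v → T? (W v)) (cartesianProduct (allFin n) (allFin 3))

HW : (n : ℕ) → Subset n → Graph
HW n W = proj₁ (replicateAll (H n) (elems n W))

CondA : (n : ℕ) → Subset n → Set
CondA n W = Σ (Fin n) λ i → Σ (Fin 3) λ j → Σ (Fin 3) λ j' →
              j ≢ j' × T (W (i , j)) × T (W (i , j'))

countR0 : (n : ℕ) → Subset n → ℕ
countR0 n W = length (filter (λ i → T? (W (i , fz))) (allFin n))

Walk : (n : ℕ) → List (HV n) → Set
Walk n []            = ⊤
Walk n (x ∷ [])      = ⊤
Walk n (x ∷ y ∷ xs)  = HE n x y × Walk n (y ∷ xs)

InWminusR0 : (n : ℕ) → Subset n → HV n → Set
InWminusR0 n W (i , j) = T (W (i , j)) × j ≢ fz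

CondC : (n : ℕ) → Subset n → Set
CondC n W = Σ (List (HV n)) λ p →
              Unique p × All (InWminusR0 n W) p × Walk n p × length p ≥ n

module Submission where

-- In a 4-colouring of a graph in which some vertices have been replicated, two adjacent
-- replicated vertices u, w and their copies u′, w′ span a K₄, so the colour pair {u, u′}
-- is the complement of {w, w′}.  Along a walk through replicated vertices the pair thus
-- alternates, and after an odd number of steps the pair at the end is the complement of
-- the pair at the start; a common neighbour of both ends then sees all four colours.
-- Each hypothesis yields such a configuration avoiding some vertex d, so already
-- H_n^(W) − d is not 4-colourable:
--   (a) two vertices of one column, with the third vertex of the column as common neighbour;
--   (b) R₀ minus the (at most one) vertex v outside W, a path with n − 2 edges (odd) whose
--       ends are both adjacent to v;
--   (c) R₁ ∪ R₂ is a cycle of length 2n; a path of n vertices in it that never stays in a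
--       column (otherwise (a) applies) runs monotonically around it, so its n − 1 edges (odd)
--       lead from its first vertex x to a neighbour of the column mate of x.

open import Defs
open import Data.Nat using (ℕ; zero; suc; _+_; _*_; _∸_; _≤_; _<_; _≥_; s≤s; z≤n; NonZero; _<?_)
open import Data.Nat.Properties
open import Data.Nat.Divisibility using (∣-refl)
open import Data.Nat.DivMod
  using (_%_; _/_; _mod_; m%n<n; m<n⇒m%n≡m; n%n≡0; %-distribˡ-+; m%n%n≡m%n; m≤n⇒[n∸m]%m≡n%m;
         [m+n]%n≡m%n; %-remove-+ˡ; m≡m%n+[m/n]*n)
open import Data.Fin using (Fin; toℕ) renaming (zero to fz; suc to fs)
import Data.Fin as Fin
open import Data.Fin.Properties using (toℕ-fromℕ<; toℕ-injective; toℕ<n; any?; <⇒notInjective)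
open import Data.Fin.Patterns using (0F; 1F; 2F)
open import Data.Bool using (T)
open import Data.Bool.Properties using (T?)
open import Data.Maybe using (just; nothing)
open import Data.Maybe.Properties using (just-injective) renaming (≡-dec to Maybe-≡-dec)
open import Data.Product using (Σ; ∃-syntax; _×_; _,_; proj₁; proj₂)
open import Data.Product.Properties using (≡-dec)
open import Data.Sum using (_⊎_; inj₁; inj₂)
open import Data.Empty using (⊥; ⊥-elim)
open import Data.List using (List; []; _∷_; filter; length; allFin)
open import Data.List.Properties using (filter-reject; filter-notAll; length-tabulate)
open import Data.List.Membership.Propositional using (_∈_)
open import Data.List.Membership.Propositional.Properties using (∈-filter⁺; ∈-cartesianProduct⁺; ∈-allFin)
open import Data.List.Relation.Unary.All using (All; _∷_)
open import Data.List.Relation.Unary.Any as Any using (here; there)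
open import Data.List.Relation.Unary.Unique.Propositional using (Unique; _∷_)
open import Data.Vec using ([]; _∷_)
open import Data.Vec.Relation.Unary.All using ([]; _∷_)
import Data.Vec.Relation.Unary.Unique.Propositional as Vec
open Vec using ([]; _∷_)
open import Data.Vec.Relation.Unary.Unique.Propositional.Properties using (lookup-injective)
open import Function using (_∘_)
open import Relation.Nullary using (¬_; yes; no; ¬?)
open import Relation.Nullary.Decidable using (_×-dec_; decidable-stable)
open import Relation.Unary using (Decidable)
open import Relation.Binary.Definitions using (DecidableEquality; Symmetric)
open import Relation.Binary.PropositionalEquality

_∉₂_ : Fin 4 → Fin 4 × Fin 4 → Set
x ∉₂ (a , b) = x ≢ a × x ≢ b

Apart : Fin 4 × Fin 4 → Fin 4 × Fin 4 → Set
Apart (a , b) (c , d) = a ≢ b × c ≢ d × a ∉₂ (c , d) × b ∉₂ (c , d)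

apart-sym : ∀ {P Q} → Apart P Q → Apart Q P
apart-sym (a≢b , c≢d , (a≢c , a≢d) , (b≢c , b≢d)) =
  c≢d , a≢b , (≢-sym a≢c , ≢-sym b≢c) , (≢-sym a≢d , ≢-sym b≢d)

apart-covers : ∀ {P Q x} → Apart P Q → x ∉₂ P → x ∉₂ Q → ⊥
apart-covers {x = x} (a≢b , c≢d , (a≢c , a≢d) , (b≢c , b≢d)) (x≢a , x≢b) (x≢c , x≢d) =
  <⇒notInjective ≤-refl (λ {i} {j} → lookup-injective five-distinct i j)
  where
  five-distinct : Vec.Unique (_ ∷ _ ∷ _ ∷ _ ∷ x ∷ [])
  five-distinct = (a≢b ∷ a≢c ∷ a≢d ∷ ≢-sym x≢a ∷ [])
                ∷ (b≢c ∷ b≢d ∷ ≢-sym x≢b ∷ [])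
                ∷ (c≢d ∷ ≢-sym x≢c ∷ [])
                ∷ (≢-sym x≢d ∷ [])
                ∷ [] ∷ []

apart-separates : ∀ {P Q x y} → Apart P Q → x ∉₂ P → y ∉₂ Q → x ≢ y
apart-separates PQ x∉P y∉Q refl = apart-covers PQ x∉P y∉Q

apart-odd-step : ∀ {P Q R S} → Apart P Q → Apart Q R → Apart R S → Apart P S
apart-odd-step {Q = Q} {R} {g , h} (a≢b , _ , a∉Q , b∉Q) QR RS with apart-sym RS
... | g≢h , _ , g∉R , h∉R =
  a≢b , g≢h , (sep a∉Q g∉R , sep a∉Q h∉R) , (sep b∉Q g∉R , sep b∉Q h∉R)
  where
  sep : ∀ {x y} → x ∉₂ Q → y ∉₂ R → x ≢ y
  sep = apart-separates QR

apart-odd : (p : ℕ → Fin 4 × Fin 4) (k : ℕ)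
  → (∀ t → t < suc (k * 2) → Apart (p t) (p (suc t)))
  → Apart (p 0) (p (suc (k * 2)))
apart-odd p zero    step = step 0 ≤-refl
apart-odd p (suc k) step =
  apart-odd-step (apart-odd p k (λ t t<ℓ → step t (≤-trans t<ℓ (m≤n+m _ 2))))
                 (step (suc (k * 2)) (n≤1+n _)) (step (suc (suc (k * 2))) ≤-refl)

squeeze : ∀ {a b m} → a ≡ m + b → a ≤ m → b ≡ 0 × a ≡ m
squeeze {b = zero}  {m} refl _   = refl , +-identityʳ m
squeeze {b = suc b} {m} refl a≤m = ⊥-elim (m+1+n≰m m a≤m)

-- b ≡ a + 1 (mod N), for a, b < N
CyclicSucc : ℕ → ℕ → ℕ → Set
CyclicSucc N a b = suc a ≡ b ⊎ (suc a ≡ N × b ≡ 0)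

module _ {N : ℕ} .{{_ : NonZero N}} where

  [k+m%N]%N≡[k+m]%N : ∀ k m → (k + m % N) % N ≡ (k + m) % N
  [k+m%N]%N≡[k+m]%N k m = begin
    (k + m % N) % N           ≡⟨ %-distribˡ-+ k (m % N) N ⟩
    (k % N + m % N % N) % N   ≡⟨ cong (λ r → (k % N + r) % N) (m%n%n≡m%n m N) ⟩
    (k % N + m % N) % N       ≡⟨ %-distribˡ-+ k m N ⟨
    (k + m) % N               ∎
    where open ≡-Reasoning

  %-cyclicSucc : ∀ m → CyclicSucc N (m % N) (suc m % N)
  %-cyclicSucc m with suc (m % N) <? N
  ... | yes 1+r<N = inj₁ (trans (sym (m<n⇒m%n≡m 1+r<N)) ([k+m%N]%N≡[k+m]%N 1 m))
  ... | no  1+r≮N = inj₂ (1+r≡N , (begin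
    suc m % N          ≡⟨ [k+m%N]%N≡[k+m]%N 1 m ⟨
    suc (m % N) % N    ≡⟨ cong (_% N) 1+r≡N ⟩
    N % N              ≡⟨ n%n≡0 N ⟩
    0                  ∎))
    where
    open ≡-Reasoning
    1+r≡N : suc (m % N) ≡ N
    1+r≡N = ≤-antisym (m%n<n m N) (≮⇒≥ 1+r≮N)

  cyclicSucc⇒≡suc% : ∀ {a b} → b < N → CyclicSucc N a b → b ≡ suc a % N
  cyclicSucc⇒≡suc% b<N (inj₁ refl)          = sym (m<n⇒m%n≡m b<N)
  cyclicSucc⇒≡suc% _   (inj₂ (1+a≡N , refl)) = trans (sym (n%n≡0 N)) (cong (_% N) (sym 1+a≡N))

cyclicSucc-injectiveˡ : ∀ {N a b c} → CyclicSucc N a c → CyclicSucc N b c → a ≡ b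
cyclicSucc-injectiveˡ (inj₁ refl)      (inj₁ eq)         = suc-injective (sym eq)
cyclicSucc-injectiveˡ (inj₁ refl)      (inj₂ (_ , ()))
cyclicSucc-injectiveˡ (inj₂ (_ , refl)) (inj₁ ())
cyclicSucc-injectiveˡ (inj₂ (eq , _))  (inj₂ (eq′ , _)) = suc-injective (trans eq (sym eq′))

cyclicSucc-injectiveʳ : ∀ {N a b c} → b < N → c < N → CyclicSucc N a b → CyclicSucc N a c → b ≡ c
cyclicSucc-injectiveʳ _   _   (inj₁ eq)         (inj₁ eq′)        = trans (sym eq) eq′
cyclicSucc-injectiveʳ b<N _   (inj₁ refl)       (inj₂ (eq , _))   = ⊥-elim (<-irrefl eq b<N)
cyclicSucc-injectiveʳ _   c<N (inj₂ (eq , _))   (inj₁ refl)       = ⊥-elim (<-irrefl eq c<N)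
cyclicSucc-injectiveʳ _   _   (inj₂ (_ , b≡0))  (inj₂ (_ , c≡0))  = trans b≡0 (sym c≡0)

module _ {N : ℕ} .{{_ : NonZero N}} (p : ℕ → ℕ) (p<N : ∀ t → p t < N) where

  private
    Forward Backward : ℕ → Set
    Forward  t = CyclicSucc N (p t) (p (suc t))
    Backward t = CyclicSucc N (p (suc t)) (p t)

  forward-position : ∀ {ℓ} → (∀ {t} → t < ℓ → Forward t)
    → ∀ {t} → t ≤ ℓ → p t ≡ (t + p 0) % N
  forward-position fwd {zero}  _     = sym (m<n⇒m%n≡m (p<N 0))
  forward-position fwd {suc t} 1+t≤ℓ = begin
    p (suc t)                ≡⟨ cyclicSucc⇒≡suc% (p<N (suc t)) (fwd 1+t≤ℓ) ⟩
    suc (p t) % N            ≡⟨ cong (λ r → suc r % N) (forward-position fwd (<⇒≤ 1+t≤ℓ)) ⟩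
    suc ((t + p 0) % N) % N  ≡⟨ [k+m%N]%N≡[k+m]%N 1 (t + p 0) ⟩
    suc (t + p 0) % N        ∎
    where open ≡-Reasoning

  backward-position : ∀ {ℓ} → (∀ {t} → t < ℓ → Backward t)
    → ∀ {t} → t ≤ ℓ → p 0 ≡ (t + p t) % N
  backward-position bwd {zero}  _     = sym (m<n⇒m%n≡m (p<N 0))
  backward-position bwd {suc t} 1+t≤ℓ = begin
    p 0                            ≡⟨ backward-position bwd (<⇒≤ 1+t≤ℓ) ⟩
    (t + p t) % N                  ≡⟨ cong (λ r → (t + r) % N)
                                               (cyclicSucc⇒≡suc% (p<N t) (bwd 1+t≤ℓ)) ⟩
    (t + suc (p (suc t)) % N) % N  ≡⟨ [k+m%N]%N≡[k+m]%N t (suc (p (suc t))) ⟩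
    (t + suc (p (suc t))) % N      ≡⟨ cong (_% N) (+-suc t (p (suc t))) ⟩
    (suc t + p (suc t)) % N        ∎
    where open ≡-Reasoning

  winding : ∀ ℓ → (∀ {t} → t < ℓ → Forward t ⊎ Backward t)
    → (∀ {t} → suc t < ℓ → p t ≢ p (suc (suc t)))
    → p ℓ ≡ (ℓ + p 0) % N ⊎ p 0 ≡ (ℓ + p ℓ) % N
  winding zero    _    _            = inj₁ (sym (m<n⇒m%n≡m (p<N 0)))
  winding (suc ℓ) step no-backtrack with step (s≤s z≤n)
  ... | inj₁ f₀ = inj₁ (forward-position all-forward ≤-refl)
    where
    all-forward : ∀ {t} → t < suc ℓ → Forward t
    all-forward {zero}  _     = f₀
    all-forward {suc t} 1+t<ℓ with step 1+t<ℓ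
    ... | inj₁ f = f
    ... | inj₂ b = ⊥-elim (no-backtrack 1+t<ℓ
                     (cyclicSucc-injectiveˡ (all-forward (<⇒≤ 1+t<ℓ)) b))
  ... | inj₂ b₀ = inj₂ (backward-position all-backward ≤-refl)
    where
    all-backward : ∀ {t} → t < suc ℓ → Backward t
    all-backward {zero}  _     = b₀
    all-backward {suc t} 1+t<ℓ with step 1+t<ℓ
    ... | inj₂ b = b
    ... | inj₁ f = ⊥-elim (no-backtrack 1+t<ℓ
                     (cyclicSucc-injectiveʳ (p<N t) (p<N (suc (suc t)))
                        (all-backward (<⇒≤ 1+t<ℓ)) f))

[d+m]%N≢m : ∀ {N d m} .{{_ : NonZero N}} → 0 < d → d < N → m < N → (d + m) % N ≢ m
[d+m]%N≢m {N} {d} {m} 0<d d<N m<N [d+m]%N≡m with d + m <? N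
... | yes d+m<N = <-irrefl (trans (sym [d+m]%N≡m) (m<n⇒m%n≡m d+m<N)) (m<n+m m 0<d)
... | no  d+m≮N = <-irrefl (+-cancelʳ-≡ m d N (begin
    d + m                ≡⟨ m∸n+n≡m N≤d+m ⟨
    (d + m ∸ N) + N      ≡⟨ cong (_+ N) d+m∸N≡m ⟩
    m + N                ≡⟨ +-comm m N ⟩
    N + m                ∎)) d<N
  where
  open ≡-Reasoning
  N≤d+m : N ≤ d + m
  N≤d+m = ≮⇒≥ d+m≮N
  d+m∸N≡m : d + m ∸ N ≡ m
  d+m∸N≡m = begin
    d + m ∸ N             ≡⟨ m<n⇒m%n≡m (m<n+o⇒m∸n<o (d + m) N (+-mono-< d<N m<N)) ⟨
    (d + m ∸ N) % N       ≡⟨ m≤n⇒[n∸m]%m≡n%m N≤d+m ⟩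
    (d + m) % N           ≡⟨ [d+m]%N≡m ⟩
    m                     ∎

¬critical : ∀ {G} v → ¬ Colourable 4 (delete G v) → ¬ Critical5 G
¬critical v ¬col (_ , deletions-colourable) = ¬col (deletions-colourable v)

colourable-delete : ∀ {k G} v → Colourable k G → Colourable k (delete G v)
colourable-delete v (c , proper) = c ∘ proj₁ , λ x y → proper (proj₁ x) (proj₁ y)

extend-colouring : ∀ {G} → DecidableEquality (V G) → ∀ v → Colourable 4 (delete G v)
  → Σ (V G → Fin 4) λ c → ∀ {x y} → x ≢ v → y ≢ v → E G x y → c x ≢ c y
extend-colouring {G} _≟_ v (c , proper) = c̄ , c̄-proper
  where
  c̄ : V G → Fin 4
  c̄ x with x ≟ v
  ... | yes _   = 0F
  ... | no x≢v = c (x , x≢v)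

  -- c may depend on the proof of x ≢ v, so c̄ agrees with it only at the proof it chose
  c̄-agrees : ∀ {x} → x ≢ v → Σ (x ≢ v) λ x≢v → c̄ x ≡ c (x , x≢v)
  c̄-agrees {x} x≢v with x ≟ v
  ... | yes x≡v  = ⊥-elim (x≢v x≡v)
  ... | no x≢v′ = x≢v′ , refl

  c̄-proper : ∀ {x y} → x ≢ v → y ≢ v → E G x y → c̄ x ≢ c̄ y
  c̄-proper x≢v y≢v e with c̄-agrees x≢v | c̄-agrees y≢v
  ... | p , c̄x≡cx | q , c̄y≡cy =
    λ c̄x≡c̄y → proper (_ , p) (_ , q) e (trans (sym c̄x≡cx) (trans c̄x≡c̄y c̄y≡cy))

module Replication (G : Graph) (_≟_ : DecidableEquality (V G))
                   (E-sym : Symmetric (E G)) (E-irrefl : ∀ {x} → ¬ E G x x) where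

  Gʳ : List (V G) → Graph
  Gʳ ws = proj₁ (replicateAll G ws)

  ι : ∀ ws → V G → V (Gʳ ws)
  ι ws = proj₂ (replicateAll G ws)

  -- the copy of w made when its outermost occurrence in ws is replicated
  -- (junk when w ∉ ws)
  twin : ∀ ws → V G → V (Gʳ ws)
  twin []       w = w
  twin (u ∷ ws) w with w ≟ u
  ... | yes _ = nothing
  ... | no  _ = just (twin ws w)

  Gʳ-sym : ∀ ws → Symmetric (E (Gʳ ws))
  Gʳ-sym []       e = E-sym e
  Gʳ-sym (u ∷ ws) {just x}  {just y}  e        = Gʳ-sym ws e
  Gʳ-sym (u ∷ ws) {just x}  {nothing} (inj₁ p) = inj₁ p
  Gʳ-sym (u ∷ ws) {just x}  {nothing} (inj₂ e) = inj₂ (Gʳ-sym ws e)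
  Gʳ-sym (u ∷ ws) {nothing} {just y}  (inj₁ p) = inj₁ p
  Gʳ-sym (u ∷ ws) {nothing} {just y}  (inj₂ e) = inj₂ (Gʳ-sym ws e)

  ι-edge : ∀ ws {x y} → E G x y → E (Gʳ ws) (ι ws x) (ι ws y)
  ι-edge []       e = e
  ι-edge (u ∷ ws) e = ι-edge ws e

  ι-injective : ∀ ws {x y} → ι ws x ≡ ι ws y → x ≡ y
  ι-injective []       eq = eq
  ι-injective (u ∷ ws) eq = ι-injective ws (just-injective eq)

  twin-edge : ∀ ws {w y} → w ∈ ws → y ≡ w ⊎ E G w y → E (Gʳ ws) (twin ws w) (ι ws y)
  twin-edge (u ∷ ws) {w} w∈ y∼w with w ≟ u
  twin-edge (u ∷ ws) _          (inj₁ refl) | yes refl = inj₁ refl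
  twin-edge (u ∷ ws) _          (inj₂ e)    | yes refl = inj₂ (ι-edge ws e)
  twin-edge (u ∷ ws) (here w≡u)  _          | no w≢u   = ⊥-elim (w≢u w≡u)
  twin-edge (u ∷ ws) (there w∈) y∼w         | no _     = twin-edge ws w∈ y∼w

  twin-twin-edge : ∀ ws {v w} → v ∈ ws → w ∈ ws → E G v w → E (Gʳ ws) (twin ws v) (twin ws w)
  twin-twin-edge (u ∷ ws) {v} {w} v∈ w∈ e with v ≟ u | w ≟ u
  ... | yes refl | yes refl = ⊥-elim (E-irrefl e)
  twin-twin-edge (u ∷ ws) _ (here w≡u) e  | yes refl | no w≢u = ⊥-elim (w≢u w≡u)
  twin-twin-edge (u ∷ ws) _ (there w∈) e  | yes refl | no _   =
    inj₂ (Gʳ-sym ws (twin-edge ws w∈ (inj₂ (E-sym e))))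
  twin-twin-edge (u ∷ ws) (here v≡u) _ e  | no v≢u | yes refl = ⊥-elim (v≢u v≡u)
  twin-twin-edge (u ∷ ws) (there v∈) _ e  | no _   | yes refl = inj₂ (twin-edge ws v∈ (inj₂ e))
  twin-twin-edge (u ∷ ws) (here v≡u) _ e  | no v≢u | no _     = ⊥-elim (v≢u v≡u)
  twin-twin-edge (u ∷ ws) (there v∈) (here w≡u) e | no _ | no w≢u = ⊥-elim (w≢u w≡u)
  twin-twin-edge (u ∷ ws) (there v∈) (there w∈) e | no _ | no _   = twin-twin-edge ws v∈ w∈ e

  twin≢ι : ∀ ws {w x} → w ∈ ws → twin ws w ≢ ι ws x
  twin≢ι (u ∷ ws) {w} w∈ eq with w ≟ u
  twin≢ι (u ∷ ws) w∈          () | yes _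
  twin≢ι (u ∷ ws) (here w≡u)  eq   | no w≢u = w≢u w≡u
  twin≢ι (u ∷ ws) (there w∈)  eq   | no _   = twin≢ι ws w∈ (just-injective eq)

  ≟ʳ : ∀ ws → DecidableEquality (V (Gʳ ws))
  ≟ʳ []       = _≟_
  ≟ʳ (u ∷ ws) = Maybe-≡-dec (≟ʳ ws)

  record Obstruction (ws : List (V G)) : Set where
    field
      half    : ℕ
      walk    : ℕ → V G
      apex    : V G
      outside : V G
      walk∈ws      : ∀ {t} → t ≤ suc (half * 2) → walk t ∈ ws
      walk-edge    : ∀ {t} → t < suc (half * 2) → E G (walk t) (walk (suc t))
      apex-first   : E G apex (walk 0)
      apex-last    : E G apex (walk (suc (half * 2)))
      apex≢outside : apex ≢ outside
      walk≢outside : ∀ {t} → t ≤ suc (half * 2) → walk t ≢ outside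

  module TwinColours (ws : List (V G)) (d : V G) (col : Colourable 4 (delete (Gʳ ws) (ι ws d))) where

    private
      c : V (Gʳ ws) → Fin 4
      c = proj₁ (extend-colouring (≟ʳ ws) (ι ws d) col)

      proper : ∀ {x y} → x ≢ ι ws d → y ≢ ι ws d → E (Gʳ ws) x y → c x ≢ c y
      proper = proj₂ (extend-colouring (≟ʳ ws) (ι ws d) col)

      ι≢ : ∀ {x} → x ≢ d → ι ws x ≢ ι ws d
      ι≢ x≢d = x≢d ∘ ι-injective ws

      twin≢ : ∀ {w} → w ∈ ws → twin ws w ≢ ι ws d
      twin≢ w∈ = twin≢ι ws w∈

    twin-colours : V G → Fin 4 × Fin 4
    twin-colours w = c (ι ws w) , c (twin ws w)

    neighbour∉twin-colours : ∀ {x w} → x ≢ d → w ∈ ws → w ≢ d → E G x w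
      → c (ι ws x) ∉₂ twin-colours w
    neighbour∉twin-colours x≢d w∈ w≢d e =
        proper (ι≢ x≢d) (ι≢ w≢d) (ι-edge ws e)
      , ≢-sym (proper (twin≢ w∈) (ι≢ x≢d) (twin-edge ws w∈ (inj₂ (E-sym e))))

    -- u, u′, w, w′ span a K₄
    twin-colours-apart : ∀ {u w} → u ∈ ws → w ∈ ws → u ≢ d → w ≢ d → E G u w
      → Apart (twin-colours u) (twin-colours w)
    twin-colours-apart u∈ w∈ u≢d w≢d e =
        ≢-sym (proper (twin≢ u∈) (ι≢ u≢d) (twin-edge ws u∈ (inj₁ refl)))
      , ≢-sym (proper (twin≢ w∈) (ι≢ w≢d) (twin-edge ws w∈ (inj₁ refl)))
      , neighbour∉twin-colours u≢d w∈ w≢d e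
      , ( proper (twin≢ u∈) (ι≢ w≢d) (twin-edge ws u∈ (inj₂ e))
        , proper (twin≢ u∈) (twin≢ w∈) (twin-twin-edge ws u∈ w∈ e))

  obstruction⇒¬colourable : ∀ {ws} (O : Obstruction ws)
    → ¬ Colourable 4 (delete (Gʳ ws) (ι ws (Obstruction.outside O)))
  obstruction⇒¬colourable {ws} O col =
    apart-covers (apart-odd (twin-colours ∘ walk) half walk-apart)
      (neighbour∉twin-colours apex≢outside (walk∈ws z≤n) (walk≢outside z≤n) apex-first)
      (neighbour∉twin-colours apex≢outside (walk∈ws ≤-refl) (walk≢outside ≤-refl) apex-last)
    where
    open Obstruction O
    open TwinColours ws outside col
    walk-apart : ∀ t → t < suc (half * 2) → Apart (twin-colours (walk t)) (twin-colours (walk (suc t)))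
    walk-apart t t<ℓ = twin-colours-apart (walk∈ws (<⇒≤ t<ℓ)) (walk∈ws t<ℓ)
                         (walk≢outside (<⇒≤ t<ℓ)) (walk≢outside t<ℓ) (walk-edge t<ℓ)

  obstruction⇒χ≥5∧¬critical : ∀ {ws} → Obstruction ws → χ≥5 (Gʳ ws) × ¬ Critical5 (Gʳ ws)
  obstruction⇒χ≥5∧¬critical {ws} O =
      obstruction⇒¬colourable O ∘ colourable-delete (ι ws d)
    , ¬critical (ι ws d) (obstruction⇒¬colourable O)
    where d = Obstruction.outside O

length-filter-reject₂ : ∀ {A : Set} {P : A → Set} (P? : Decidable P) {a b xs}
  → a ∈ xs → b ∈ xs → a ≢ b → ¬ P a → ¬ P b → 2 + length (filter P? xs) ≤ length xs
length-filter-reject₂ P? (here refl) (here refl) a≢b _ _ = ⊥-elim (a≢b refl)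
length-filter-reject₂ P? {xs = _ ∷ xs} (here refl) (there b∈) _ ¬Pa ¬Pb
  rewrite filter-reject P? {xs = xs} ¬Pa = s≤s (filter-notAll P? xs (Any.map (λ { refl → ¬Pb }) b∈))
length-filter-reject₂ P? {xs = _ ∷ xs} (there a∈) (here refl) _ ¬Pa ¬Pb
  rewrite filter-reject P? {xs = xs} ¬Pb = s≤s (filter-notAll P? xs (Any.map (λ { refl → ¬Pa }) a∈))
length-filter-reject₂ P? {xs = x ∷ xs} (there a∈) (there b∈) a≢b ¬Pa ¬Pb with P? x
... | yes _ = s≤s (length-filter-reject₂ P? a∈ b∈ a≢b ¬Pa ¬Pb)
... | no  _ = m≤n⇒m≤1+n (length-filter-reject₂ P? a∈ b∈ a≢b ¬Pa ¬Pb)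

nth : {A : Set} → A → List A → ℕ → A
nth d []       _       = d
nth d (x ∷ xs) zero    = x
nth d (x ∷ xs) (suc t) = nth d xs t

All-nth : ∀ {A : Set} {P : A → Set} {d xs t} → All P xs → t < length xs → P (nth d xs t)
All-nth {t = zero}  (px ∷ _)  _           = px
All-nth {t = suc t} (_  ∷ ps) (s≤s t<∣xs∣) = All-nth ps t<∣xs∣

Unique-nth : ∀ {A : Set} {d : A} {xs t u} → Unique xs → t < u → u < length xs → nth d xs t ≢ nth d xs u
Unique-nth {xs = _ ∷ _} {zero}  {suc u} (x∉xs ∷ _) _ (s≤s u<∣xs∣) = All-nth x∉xs u<∣xs∣
Unique-nth {xs = _ ∷ _} {suc t} {suc u} (_ ∷ xs-unique) (s≤s t<u) (s≤s u<∣xs∣) =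
  Unique-nth xs-unique t<u u<∣xs∣

HE-sym : ∀ {n} → Symmetric (HE n)
HE-sym (inj₁ (i≡i′ , j≢j′))                 = inj₁ (sym i≡i′ , ≢-sym j≢j′)
HE-sym (inj₂ (inj₁ (j≡j′ , i′≡1+i)))        = inj₂ (inj₂ (inj₁ (sym j≡j′ , i′≡1+i)))
HE-sym (inj₂ (inj₂ (inj₁ (j≡j′ , i≡1+i′)))) = inj₂ (inj₁ (sym j≡j′ , i≡1+i′))
HE-sym (inj₂ (inj₂ (inj₂ (inj₁ e))))        = inj₂ (inj₂ (inj₂ (inj₂ e)))
HE-sym (inj₂ (inj₂ (inj₂ (inj₂ e))))        = inj₂ (inj₂ (inj₂ (inj₁ e)))

HE-irrefl : ∀ {m x} → ¬ HE (suc (suc m)) x x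
HE-irrefl (inj₁ (_ , j≢j))                         = j≢j refl
HE-irrefl (inj₂ (inj₁ (_ , i≡1+i)))                = 1+n≢n (sym i≡1+i)
HE-irrefl (inj₂ (inj₂ (inj₁ (_ , i≡1+i))))         = 1+n≢n (sym i≡1+i)
HE-irrefl (inj₂ (inj₂ (inj₂ (inj₁ (i≡0 , i≡1+m , _))))) = 1+n≢0 (trans (sym i≡1+m) i≡0)
HE-irrefl (inj₂ (inj₂ (inj₂ (inj₂ (i≡0 , i≡1+m , _))))) = 1+n≢0 (trans (sym i≡1+m) i≡0)

_≟ᴴ_ : ∀ {n} → DecidableEquality (HV n)
_≟ᴴ_ = ≡-dec Fin._≟_ Fin._≟_

∈-elems : ∀ {n} (W : Subset n) {v} → T (W v) → v ∈ elems n W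
∈-elems W {i , j} = ∈-filter⁺ (λ v → T? (W v)) (∈-cartesianProduct⁺ (∈-allFin i) (∈-allFin j))

Walk-nth : ∀ {n d xs t} → Walk n xs → suc t < length xs → HE n (nth d xs t) (nth d xs (suc t))
Walk-nth {xs = _ ∷ []}     {zero}  _          (s≤s ())
Walk-nth {xs = _ ∷ _ ∷ _}  {zero}  (e , _)    _              = e
Walk-nth {xs = _ ∷ y ∷ xs} {suc t} (_ , walk) (s≤s 2+t<∣xs∣) = Walk-nth {xs = y ∷ xs} walk 2+t<∣xs∣

third : (j j′ : Fin 3) → j ≢ j′ → ∃[ k ] k ≢ j × k ≢ j′
third 0F 0F j≢j′ = ⊥-elim (j≢j′ refl)
third 0F 1F _    = 2F , (λ ()) , (λ ())
third 0F 2F _    = 1F , (λ ()) , (λ ())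
third 1F 0F _    = 2F , (λ ()) , (λ ())
third 1F 1F j≢j′ = ⊥-elim (j≢j′ refl)
third 1F 2F _    = 0F , (λ ()) , (λ ())
third 2F 0F _    = 1F , (λ ()) , (λ ())
third 2F 1F _    = 0F , (λ ()) , (λ ())
third 2F 2F j≢j′ = ⊥-elim (j≢j′ refl)

other : ∀ {m} → Fin (suc (suc m)) → Fin (suc (suc m))
other fz     = fs fz
other (fs _) = fz

other≢ : ∀ {m} (i : Fin (suc (suc m))) → other i ≢ i
other≢ fz     ()
other≢ (fs _) ()

module Hn (m : ℕ) where

  n : ℕ
  n = suc (suc m)

  open Replication (H n) _≟ᴴ_ HE-sym HE-irrefl public

  column-obstruction : ∀ W → CondA n W → Obstruction (elems n W)
  column-obstruction W (i , j , j′ , j≢j′ , Wj , Wj′) with third j j′ j≢j′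
  ... | k , k≢j , k≢j′ = record
    { half         = 0
    ; walk         = λ t → i , row t
    ; apex         = i , k
    ; outside      = other i , 0F
    ; walk∈ws      = λ { {zero} _ → ∈-elems W Wj ; {suc _} _ → ∈-elems W Wj′ }
    ; walk-edge    = λ { {zero} _ → inj₁ (refl , j≢j′) ; {suc _} (s≤s ()) }
    ; apex-first   = inj₁ (refl , k≢j)
    ; apex-last    = inj₁ (refl , k≢j′)
    ; apex≢outside = off-column
    ; walk≢outside = λ _ → off-column
    }
    where
    row : ℕ → Fin 3
    row zero    = j
    row (suc _) = j′
    off-column : ∀ {l} → (i , l) ≢ (other i , 0F)
    off-column eq = other≢ i (sym (cong proj₁ eq))

-- Case (b): the row R₀

R₀-missing-at-most-one : ∀ {n} (W : Subset (suc n)) → countR0 (suc n) W ≥ n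
  → ∃[ kk ] ∀ i → i ≢ kk → T (W (i , 0F))
R₀-missing-at-most-one {n} W count≥n with any? (λ i → ¬? (T? (W (i , 0F))))
... | no none-missing = 0F , λ i _ → decidable-stable (T? _) (λ ¬Wi → none-missing (i , ¬Wi))
... | yes (a , ¬Wa) with any? (λ i → ¬? (i Fin.≟ a) ×-dec ¬? (T? (W (i , 0F))))
...   | no no-other = a , λ i i≢a → decidable-stable (T? _) (λ ¬Wi → no-other (i , i≢a , ¬Wi))
...   | yes (b , b≢a , ¬Wb) = ⊥-elim (1+n≰n (begin
  2 + n                                                ≤⟨ s≤s (s≤s count≥n) ⟩
  2 + countR0 (suc n) W                                ≤⟨ length-filter-reject₂ (λ i → T? (W (i , 0F)))
                                                            (∈-allFin b) (∈-allFin a) b≢a ¬Wb ¬Wa ⟩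
  length (allFin (suc n))                              ≡⟨ length-tabulate (λ i → i) ⟩
  suc n                                                ∎))
  where open ≤-Reasoning

module Row₀ (k : ℕ) where
  open Hn (suc (k * 2))

  row : ℕ → HV n
  row r = r mod n , 0F

  toℕ-mod : ∀ r → toℕ (r mod n) ≡ r % n
  toℕ-mod r = toℕ-fromℕ< _

  cyclicSucc⇒edge : ∀ {i i′} → CyclicSucc n (toℕ i) (toℕ i′) → HE n (i , 0F) (i′ , 0F)
  cyclicSucc⇒edge (inj₁ 1+i≡i′)         = inj₂ (inj₁ (refl , sym 1+i≡i′))
  cyclicSucc⇒edge (inj₂ (1+i≡n , i′≡0)) = inj₂ (inj₂ (inj₂ (inj₂ (i′≡0 , suc-injective 1+i≡n , refl))))

  row-edge : ∀ r → HE n (row r) (row (suc r))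
  row-edge r = cyclicSucc⇒edge (subst₂ (CyclicSucc n) (sym (toℕ-mod r)) (sym (toℕ-mod (suc r))) (%-cyclicSucc r))

  row-≡ : ∀ {r r′} → r % n ≡ r′ % n → row r ≡ row r′
  row-≡ {r} {r′} eq = cong (_, 0F) (toℕ-injective (trans (toℕ-mod r) (trans eq (sym (toℕ-mod r′)))))

  row≢outside : ∀ r → row r ≢ (0F , 1F)
  row≢outside r ()

  row-obstruction : ∀ W (kk : Fin n) → (∀ i → i ≢ kk → T (W (i , 0F))) → Obstruction (elems n W)
  row-obstruction W kk R₀∖kk⊆W = record
    { half         = k
    ; walk         = λ t → row (suc t + toℕ kk)
    ; apex         = row (toℕ kk)
    ; outside      = 0F , 1F
    ; walk∈ws      = λ {t} t≤ℓ → ∈-elems W (R₀∖kk⊆W _ (λ eq →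
                       [d+m]%N≢m (s≤s z≤n) (s≤s (s≤s t≤ℓ)) (toℕ<n kk)
                         (trans (sym (toℕ-mod (suc t + toℕ kk))) (cong toℕ eq))))
    ; walk-edge    = λ {t} _ → row-edge (suc t + toℕ kk)
    ; apex-first   = row-edge (toℕ kk)
    ; apex-last    = subst (λ v → HE n v (row (suc (suc (k * 2)) + toℕ kk)))
                       (row-≡ {n + toℕ kk} {toℕ kk} (%-remove-+ˡ {n} (toℕ kk) {n} ∣-refl))
                       (HE-sym (row-edge (suc (suc (k * 2)) + toℕ kk)))
    ; apex≢outside = row≢outside (toℕ kk)
    ; walk≢outside = λ {t} _ → row≢outside (suc t + toℕ kk)
    }

-- Case (c): the rim R₁ ∪ R₂

module Rim (k : ℕ) where
  open Hn (k * 2)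

  N : ℕ
  N = n + n

  OffR₀ : HV n → Set
  OffR₀ (_ , j) = j ≢ 0F

  -- R₁ ∪ R₂ is a cycle of length 2n: (i , 1) ↦ i and (i , 2) ↦ n + i (R₀ ↦ 0 is junk)
  pos : HV n → ℕ
  pos (_ , 0F) = 0
  pos (i , 1F) = toℕ i
  pos (i , 2F) = n + toℕ i

  mate : HV n → HV n
  mate (i , 0F) = i , 0F
  mate (i , 1F) = i , 2F
  mate (i , 2F) = i , 1F

  pos<N : ∀ x → pos x < N
  pos<N (_ , 0F) = s≤s z≤n
  pos<N (i , 1F) = <-≤-trans (toℕ<n i) (m≤m+n n n)
  pos<N (i , 2F) = +-monoʳ-< n (toℕ<n i)

  pos-injective : ∀ {x y} → OffR₀ x → OffR₀ y → pos x ≡ pos y → x ≡ y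
  pos-injective {_ , 0F} x∉R₀ _ _ = ⊥-elim (x∉R₀ refl)
  pos-injective {_} {_ , 0F} _ y∉R₀ _ = ⊥-elim (y∉R₀ refl)
  pos-injective {i , 1F} {i′ , 1F} _ _ eq = cong (_, 1F) (toℕ-injective eq)
  pos-injective {i , 2F} {i′ , 2F} _ _ eq = cong (_, 2F) (toℕ-injective (+-cancelˡ-≡ n _ _ eq))
  pos-injective {i , 1F} {i′ , 2F} _ _ eq = ⊥-elim (<⇒≱ (toℕ<n i) (subst (n ≤_) (sym eq) (m≤m+n n _)))
  pos-injective {i , 2F} {i′ , 1F} _ _ eq = ⊥-elim (<⇒≱ (toℕ<n i′) (subst (n ≤_) eq (m≤m+n n _)))

  cyclicSucc⇒edge : ∀ {x y} → OffR₀ x → OffR₀ y → CyclicSucc N (pos x) (pos y) → HE n x y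
  cyclicSucc⇒edge {_ , 0F} x∉R₀ _ _ = ⊥-elim (x∉R₀ refl)
  cyclicSucc⇒edge {_} {_ , 0F} _ y∉R₀ _ = ⊥-elim (y∉R₀ refl)
  cyclicSucc⇒edge {i , 1F} {i′ , 1F} _ _ (inj₁ 1+i≡i′) = inj₂ (inj₁ (refl , sym 1+i≡i′))
  cyclicSucc⇒edge {i , 1F} {i′ , 1F} _ _ (inj₂ (1+i≡N , _)) =
    ⊥-elim (≤⇒≯ (toℕ<n i) (subst (n <_) (sym 1+i≡N) (m<m+n n (s≤s z≤n))))
  cyclicSucc⇒edge {i , 1F} {i′ , 2F} _ _ (inj₁ 1+i≡n+i′) with squeeze 1+i≡n+i′ (toℕ<n i)
  ... | i′≡0 , 1+i≡n = inj₂ (inj₂ (inj₂ (inj₂ (i′≡0 , suc-injective 1+i≡n , refl))))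
  cyclicSucc⇒edge {i , 1F} {i′ , 2F} _ _ (inj₂ (_ , ()))
  cyclicSucc⇒edge {i , 2F} {i′ , 1F} _ _ (inj₁ 1+n+i≡i′) =
    ⊥-elim (<⇒≱ (toℕ<n i′) (subst (n ≤_) 1+n+i≡i′ (≤-trans (m≤m+n n _) (n≤1+n _))))
  cyclicSucc⇒edge {i , 2F} {i′ , 1F} _ _ (inj₂ (1+n+i≡N , i′≡0)) =
    inj₂ (inj₂ (inj₂ (inj₂
      (i′≡0 , suc-injective (+-cancelˡ-≡ n _ _ (trans (+-suc n (toℕ i)) 1+n+i≡N)) , refl))))
  cyclicSucc⇒edge {i , 2F} {i′ , 2F} _ _ (inj₁ 1+n+i≡n+i′) =
    inj₂ (inj₁ (refl , sym (+-cancelˡ-≡ n _ _ (trans (+-suc n (toℕ i)) 1+n+i≡n+i′))))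
  cyclicSucc⇒edge {i , 2F} {i′ , 2F} _ _ (inj₂ (_ , ()))

  edge⇒cyclicSucc : ∀ {x y} → OffR₀ x → OffR₀ y → proj₁ x ≢ proj₁ y → HE n x y
    → CyclicSucc N (pos x) (pos y) ⊎ CyclicSucc N (pos y) (pos x)
  edge⇒cyclicSucc _ _ i≢i′ (inj₁ (i≡i′ , _)) = ⊥-elim (i≢i′ i≡i′)
  edge⇒cyclicSucc {_ , 0F} x∉R₀ _ _ _ = ⊥-elim (x∉R₀ refl)
  edge⇒cyclicSucc {_} {_ , 0F} _ y∉R₀ _ _ = ⊥-elim (y∉R₀ refl)
  edge⇒cyclicSucc {i , 1F} {i′ , 1F} _ _ _ (inj₂ (inj₁ (_ , i′≡1+i))) =
    inj₁ (inj₁ (sym i′≡1+i))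
  edge⇒cyclicSucc {i , 2F} {i′ , 2F} _ _ _ (inj₂ (inj₁ (_ , i′≡1+i))) =
    inj₁ (inj₁ (trans (sym (+-suc n (toℕ i))) (cong (n +_) (sym i′≡1+i))))
  edge⇒cyclicSucc {i , 1F} {i′ , 1F} _ _ _ (inj₂ (inj₂ (inj₁ (_ , i≡1+i′)))) =
    inj₂ (inj₁ (sym i≡1+i′))
  edge⇒cyclicSucc {i , 2F} {i′ , 2F} _ _ _ (inj₂ (inj₂ (inj₁ (_ , i≡1+i′)))) =
    inj₂ (inj₁ (trans (sym (+-suc n (toℕ i′))) (cong (n +_) (sym i≡1+i′))))
  edge⇒cyclicSucc {i , 1F} {i′ , 2F} _ _ _ (inj₂ (inj₂ (inj₂ (inj₁ (i≡0 , i′≡n-1 , _))))) =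
    inj₂ (inj₂ (trans (sym (+-suc n (toℕ i′))) (cong (λ r → n + suc r) i′≡n-1) , i≡0))
  edge⇒cyclicSucc {i , 2F} {i′ , 1F} _ _ _ (inj₂ (inj₂ (inj₂ (inj₁ (i≡0 , i′≡n-1 , _))))) =
    inj₂ (inj₁ (trans (cong suc i′≡n-1) (sym (trans (cong (n +_) i≡0) (+-identityʳ n)))))
  edge⇒cyclicSucc {i , 2F} {i′ , 1F} _ _ _ (inj₂ (inj₂ (inj₂ (inj₂ (i′≡0 , i≡n-1 , _))))) =
    inj₁ (inj₂ (trans (sym (+-suc n (toℕ i))) (cong (λ r → n + suc r) i≡n-1) , i′≡0))
  edge⇒cyclicSucc {i , 1F} {i′ , 2F} _ _ _ (inj₂ (inj₂ (inj₂ (inj₂ (i′≡0 , i≡n-1 , _))))) =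
    inj₁ (inj₁ (trans (cong suc i≡n-1) (sym (trans (cong (n +_) i′≡0) (+-identityʳ n)))))
  edge⇒cyclicSucc {_ , 1F} {_ , 1F} _ _ _ (inj₂ (inj₂ (inj₂ (inj₁ (_ , _ , ())))))
  edge⇒cyclicSucc {_ , 1F} {_ , 1F} _ _ _ (inj₂ (inj₂ (inj₂ (inj₂ (_ , _ , ())))))
  edge⇒cyclicSucc {_ , 2F} {_ , 2F} _ _ _ (inj₂ (inj₂ (inj₂ (inj₁ (_ , _ , ())))))
  edge⇒cyclicSucc {_ , 2F} {_ , 2F} _ _ _ (inj₂ (inj₂ (inj₂ (inj₂ (_ , _ , ())))))

  mate-off : ∀ {x} → OffR₀ x → OffR₀ (mate x)
  mate-off {_ , 0F} x∉R₀ = x∉R₀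
  mate-off {_ , 1F} _    = λ ()
  mate-off {_ , 2F} _    = λ ()

  mate-edge : ∀ {x} → OffR₀ x → HE n (mate x) x
  mate-edge {_ , 0F} x∉R₀ = ⊥-elim (x∉R₀ refl)
  mate-edge {_ , 1F} _    = inj₁ (refl , λ ())
  mate-edge {_ , 2F} _    = inj₁ (refl , λ ())

  pos-mate : ∀ {x} → OffR₀ x → pos (mate x) ≡ (n + pos x) % N
  pos-mate {_ , 0F} x∉R₀ = ⊥-elim (x∉R₀ refl)
  pos-mate {i , 1F} _    = sym (m<n⇒m%n≡m (pos<N (i , 2F)))
  pos-mate {i , 2F} _    = begin
    toℕ i                ≡⟨ m<n⇒m%n≡m (pos<N (i , 1F)) ⟨
    toℕ i % N            ≡⟨ [m+n]%n≡m%n (toℕ i) N ⟨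
    (toℕ i + N) % N      ≡⟨ cong (_% N) (+-comm (toℕ i) N) ⟩
    (N + toℕ i) % N      ≡⟨ cong (_% N) (+-assoc n n (toℕ i)) ⟩
    (n + (n + toℕ i)) % N ∎
    where open ≡-Reasoning

  -- mate x is n steps ahead of x on the rim
  antipode-edge : ∀ {x y} → OffR₀ x → OffR₀ y → pos y ≡ (suc (k * 2) + pos x) % N → HE n y (mate x)
  antipode-edge {x} x∉R₀ y∉R₀ pos-y = cyclicSucc⇒edge y∉R₀ (mate-off x∉R₀)
    (subst₂ (CyclicSucc N) (sym pos-y) (sym (pos-mate x∉R₀)) (%-cyclicSucc {N} (suc (k * 2) + pos x)))

  module OnPath (W : Subset n) (p : List (HV n)) (p-unique : Unique p)
                (p⊆W∖R₀ : All (InWminusR0 n W) p) (p-walk : Walk n p) (n≤∣p∣ : length p ≥ n) where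

    ℓ : ℕ
    ℓ = suc (k * 2)

    z : ℕ → HV n
    z = nth (0F , 0F) p

    z-in-range : ∀ {t} → t ≤ ℓ → t < length p
    z-in-range t≤ℓ = ≤-trans (s≤s t≤ℓ) n≤∣p∣

    z-W : ∀ {t} → t ≤ ℓ → T (W (z t))
    z-W = proj₁ ∘ All-nth p⊆W∖R₀ ∘ z-in-range

    z-off : ∀ {t} → t ≤ ℓ → OffR₀ (z t)
    z-off = proj₂ ∘ All-nth p⊆W∖R₀ ∘ z-in-range

    z-edge : ∀ {t} → t < ℓ → HE n (z t) (z (suc t))
    z-edge = Walk-nth p-walk ∘ z-in-range

    z-distinct : ∀ {t u} → t < u → u ≤ ℓ → z t ≢ z u
    z-distinct t<u = Unique-nth p-unique t<u ∘ z-in-range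

    column-step : ∀ {t} → t < ℓ → proj₁ (z t) ≡ proj₁ (z (suc t)) → CondA n W
    column-step {t} t<ℓ same-column =
      proj₁ (z t) , proj₂ (z t) , proj₂ (z (suc t))
      , (λ same-row → z-distinct ≤-refl t<ℓ (cong₂ _,_ same-column same-row))
      , z-W (<⇒≤ t<ℓ)
      , subst (λ i → T (W (i , proj₂ (z (suc t))))) (sym same-column) (z-W t<ℓ)

    rim-obstruction : ∀ a → OffR₀ a → HE n a (z 0) → HE n a (z ℓ) → Obstruction (elems n W)
    rim-obstruction a a∉R₀ first last = record
      { half         = k
      ; walk         = z
      ; apex         = a
      ; outside      = 0F , 0F
      ; walk∈ws      = ∈-elems W ∘ z-W
      ; walk-edge    = z-edge
      ; apex-first   = first
      ; apex-last    = last
      ; apex≢outside = a∉R₀ ∘ cong proj₂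
      ; walk≢outside = λ t≤ℓ → z-off t≤ℓ ∘ cong proj₂
      }

    obstruction : Obstruction (elems n W)
    obstruction with anyUpTo? (λ t → proj₁ (z t) Fin.≟ proj₁ (z (suc t))) ℓ
    ... | yes (t , t<ℓ , same-column) = column-obstruction W (column-step t<ℓ same-column)
    ... | no no-column-step with winding (pos ∘ z) (pos<N ∘ z) ℓ step no-backtrack
      where
      step : ∀ {t} → t < ℓ
        → CyclicSucc N (pos (z t)) (pos (z (suc t))) ⊎ CyclicSucc N (pos (z (suc t))) (pos (z t))
      step {t} t<ℓ = edge⇒cyclicSucc (z-off (<⇒≤ t<ℓ)) (z-off t<ℓ)
                       (λ same-column → no-column-step (t , t<ℓ , same-column)) (z-edge t<ℓ)
      no-backtrack : ∀ {t} → suc t < ℓ → pos (z t) ≢ pos (z (suc (suc t)))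
      no-backtrack {t} 2+t≤ℓ = z-distinct (n≤1+n _) 2+t≤ℓ
                               ∘ pos-injective (z-off (<⇒≤ (<-trans (n<1+n t) 2+t≤ℓ))) (z-off 2+t≤ℓ)
    ...   | inj₁ forward  = rim-obstruction (mate (z 0)) (mate-off (z-off z≤n)) (mate-edge (z-off z≤n))
                              (HE-sym (antipode-edge (z-off z≤n) (z-off ≤-refl) forward))
    ...   | inj₂ backward = rim-obstruction (mate (z ℓ)) (mate-off (z-off ≤-refl))
                              (HE-sym (antipode-edge (z-off ≤-refl) (z-off z≤n) backward))
                              (mate-edge (z-off ≤-refl))

  path-obstruction : ∀ W → CondC n W → Obstruction (elems n W)
  path-obstruction W (p , p-unique , p⊆W∖R₀ , p-walk , n≤∣p∣) =
    OnPath.obstruction W p p-unique p⊆W∖R₀ p-walk n≤∣p∣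

odd-form : ∀ n → n ≥ 3 → n % 2 ≡ 1 → ∃[ k ] n ≡ suc (suc (suc (k * 2)))
odd-form n n≥3 n%2≡1 with n / 2 | m≡m%n+[m/n]*n n 2
... | zero  | n≡n%2 with s≤s () ← subst (_≥ 3) (trans n≡n%2 (cong (_+ 0) n%2≡1)) n≥3
... | suc k | n≡n%2+[1+k]*2 = k , trans n≡n%2+[1+k]*2 (cong (_+ suc k * 2) n%2≡1)

even-form : ∀ n → n ≥ 2 → n % 2 ≡ 0 → ∃[ k ] n ≡ suc (suc (k * 2))
even-form n n≥2 n%2≡0 with n / 2 | m≡m%n+[m/n]*n n 2
... | zero  | n≡n%2 with () ← subst (_≥ 2) (trans n≡n%2 (cong (_+ 0) n%2≡0)) n≥2
... | suc k | n≡n%2+[1+k]*2 = k , trans n≡n%2+[1+k]*2 (cong (_+ suc k * 2) n%2≡0)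

lemma2p2 : (n : ℕ) → n ≥ 4 → (W : Subset n)
    → (CondA n W ⊎ (countR0 n W ≥ n ∸ 1 × n % 2 ≡ 1) ⊎ (CondC n W × n % 2 ≡ 0))
    → χ≥5 (HW n W) × ¬ Critical5 (HW n W)
lemma2p2 (suc zero) (s≤s ()) _ _
lemma2p2 (suc (suc m)) _ W (inj₁ column) =
  Hn.obstruction⇒χ≥5∧¬critical m (Hn.column-obstruction m W column)
lemma2p2 n n≥4 W (inj₂ (inj₁ (count , n%2≡1))) with odd-form n (≤-trans (n≤1+n 3) n≥4) n%2≡1
... | k , refl with R₀-missing-at-most-one W count
...   | kk , R₀∖kk⊆W =
  Hn.obstruction⇒χ≥5∧¬critical (suc (k * 2)) (Row₀.row-obstruction k W kk R₀∖kk⊆W)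
lemma2p2 n n≥4 W (inj₂ (inj₂ (path , n%2≡0))) with even-form n (≤-trans (m≤n+m 2 2) n≥4) n%2≡0
... | k , refl = Hn.obstruction⇒χ≥5∧¬critical (k * 2) (Rim.path-obstruction k W path)
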